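{- Let $r,p\ge1$, $\bm{x}_1,\ldots,\bm{x}_r\in\mathbb{C}^p$ and $c\in\mathbb{C}$, and suppose that $\bm{x}_{i_1}+\cdots+\bm{x}_{i_q}=(c,\ldots,c)\in\mathbb{C}^p$ for some distinct integers $1\le i_1,\ldots,i_q\le r$. Then for any $t_1,\ldots,t_{p-1}\in\mathbb{C}\setminus\{0,-1,-2,\ldots\}$, $$(\partial_{X_{i_1}}+\cdots+\partial_{X_{i_q}}-c)\,f^{t_1,\ldots,t_{p-1}}_{\bm{x}_1;\cdots;\bm{x}_r}=0.$$
   Context: $\mathbb{N}=\{0,1,2,\ldots\}$; $0^0=1$. For complex $z$ and $m\in\mathbb{N}$, $\binom{z}{m}=z(z-1)\cdots(z-m+1)/m!$; multinomial coefficients are $\binom{n}{\nu_1,\ldots,\nu_p}=n!/(\nu_1!\cdots\nu_p!)$. For $\bm{x}_i=(x_{i1},\ldots,x_{ip})$ ($1\le i\le r$) and $n_1,\ldots,n_r\in\mathbb{N}$ define $$c^{t_1,\ldots,t_{p-1}}_{\bm{x}_1;\cdots;\bm{x}_r}(n_1,\ldots,n_r)=\sum\frac{\prod_{i=1}^r\binom{n_i}{\nu_{i1},\ldots,\nu_{ip}}x_{i1}^{\nu_{i1}}\cdots x_{ip}^{\nu_{ip}}}{\prod_{j=1}^{p-1}\binom{n_{1j}+\cdots+n_{rj}+t_j-1}{\nu_{1j}+\cdots+\nu_{rj}}(n_{1j}+\cdots+n_{rj}+t_j)},$$ summing over all integers $n_{ij}$ with $n_i=n_{i1}\ge n_{i2}\ge\cdots\ge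 n_{ip}\ge0$ for each $i$, where $\nu_{ij}=n_{ij}-n_{i,j+1}$ for $j<p$, $\nu_{ip}=n_{ip}$ (for $p=1$ it equals $x_1^{n_1}\cdots x_r^{n_r}$). Its generating function is $f^{t_1,\ldots,t_{p-1}}_{\bm{x}_1;\cdots;\bm{x}_r}=\sum_{n_1,\ldots,n_r\ge0}c^{t_1,\ldots,t_{p-1}}_{\bm{x}_1;\cdots;\bm{x}_r}(n_1,\ldots,n_r)\frac{X_1^{n_1}\cdots X_r^{n_r}}{n_1!\cdots n_r!}\in\mathbb{C}[[X_1,\ldots,X_r]]$; $\partial_{X_i}=\partial/\partial X_i$. -}

module Defs where

open import Level using (Level; _⊔_) renaming (suc to lsuc)
open import Algebra.Bundles using (CommutativeRing)
open import Data.Nat using (ℕ; zero; suc; _∸_) renaming (_+_ to _+ℕ_)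
open import Data.Nat.Base using () renaming (_! to _!ℕ)
open import Data.Fin using (Fin; zero; suc; inject₁; fromℕ; _≟_)
open import Data.Vec using (Vec; []; _∷_; lookup)
open import Data.List using (List; []; _∷_; [_]; map; concatMap; foldr; upTo)
open import Relation.Nullary using (¬_; yes; no)

-- A field: a commutative ring with 0 ≠ 1 in which every nonzero element
-- has a multiplicative inverse (the inverse map is total; its value at 0
-- is irrelevant and never used below under the theorem's hypotheses).
record Field (c ℓ : Level) : Set (lsuc (c ⊔ ℓ)) where
  field
    commutativeRing : CommutativeRing c ℓ
  open CommutativeRing commutativeRing public
  field
    _⁻¹        : Carrier → Carrier
    ⁻¹-inverse : ∀ x → ¬ (x ≈ 0#) → x * (x ⁻¹) ≈ 1#
    0≉1        : ¬ (0# ≈ 1#)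

module FieldDefs {c ℓ : Level} (F : Field c ℓ) where
  open Field F using (Carrier; _≈_; _+_; _*_; -_; _-_; 0#; 1#; _⁻¹)

  ι : ℕ → Carrier
  ι zero    = 0#
  ι (suc n) = 1# + ι n

  CharacteristicZero : Set ℓ
  CharacteristicZero = ∀ n → ¬ (ι (suc n) ≈ 0#)

  _^_ : Carrier → ℕ → Carrier
  x ^ zero  = 1#
  x ^ suc n = x * (x ^ n)

  ΣF : (n : ℕ) → (Fin n → Carrier) → Carrier
  ΣF zero    f = 0#
  ΣF (suc n) f = f zero + ΣF n (λ k → f (suc k))

  ΠF : (n : ℕ) → (Fin n → Carrier) → Carrier
  ΠF zero    f = 1#
  ΠF (suc n) f = f zero * ΠF n (λ k → f (suc k))

  ΣL : List Carrier → Carrier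
  ΣL = foldr _+_ 0#

  fallingFactorial : Carrier → ℕ → Carrier
  fallingFactorial z zero    = 1#
  fallingFactorial z (suc m) = fallingFactorial z m * (z - ι m)

  binom : Carrier → ℕ → Carrier
  binom z m = fallingFactorial z m * (ι (m !ℕ) ⁻¹)

  multinomial : ℕ → (p : ℕ) → (Fin p → ℕ) → Carrier
  multinomial n p ν = ι (n !ℕ) * (ΠF p (λ j → ι (ν j !ℕ)) ⁻¹)

  sumℕ : (n : ℕ) → (Fin n → ℕ) → ℕ
  sumℕ zero    f = 0
  sumℕ (suc n) f = f zero +ℕ sumℕ n (λ k → f (suc k))

-- chains n = m₁ ≥ m₂ ≥ ... ≥ m_{q+1} ≥ 0 of length q+1 starting at n
chains : (q : ℕ) → ℕ → List (Vec ℕ (suc q))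
chains zero    n = [ n ∷ [] ]
chains (suc q) n = concatMap (λ m → map (n ∷_) (chains q m)) (upTo (suc n))

consF : ∀ {a} {A : Set a} {r : ℕ} → A → (Fin r → A) → Fin (suc r) → A
consF x f zero    = x
consF x f (suc i) = f i

chainTuples : (q r : ℕ) → (Fin r → ℕ) → List (Fin r → Vec ℕ (suc q))
chainTuples q zero    n = [ (λ ()) ]
chainTuples q (suc r) n =
  concatMap (λ ch → map (consF ch) (chainTuples q r (λ i → n (suc i))))
            (chains q (n zero))

nu : {q : ℕ} → Vec ℕ (suc q) → Fin (suc q) → ℕ
nu {zero}  (a ∷ [])     zero    = a
nu {suc q} (a ∷ b ∷ ms) zero    = a ∸ b
nu {suc q} (a ∷ ms)     (suc j) = nu ms j

bump : {r : ℕ} → (Fin r → ℕ) → Fin r → Fin r → ℕ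
bump n i k with k ≟ i
... | yes _ = suc (n k)
... | no  _ = n k

module CoeffDefs {c ℓ : Level} (F : Field c ℓ) where
  open Field F using (Carrier; _≈_; _+_; _*_; -_; _-_; 0#; 1#; _⁻¹)
  open FieldDefs F

  -- p = suc q ; x : Fin r → Fin p → K ; t : Fin q → K
  term : (q r : ℕ) → (Fin r → Fin (suc q) → Carrier) → (Fin q → Carrier)
       → (Fin r → ℕ) → (Fin r → Vec ℕ (suc q)) → Carrier
  term q r x t n N = numer * (denom ⁻¹)
    where
      numer = ΠF r (λ i → multinomial (n i) (suc q) (nu (N i))
                         * ΠF (suc q) (λ j → x i j ^ nu (N i) j))
      Nsum : Fin q → ℕ
      Nsum j = sumℕ r (λ i → lookup (N i) (inject₁ j))
      Vsum : Fin q → ℕ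
      Vsum j = sumℕ r (λ i → nu (N i) (inject₁ j))
      denom = ΠF q (λ j → binom (ι (Nsum j) + t j - 1#) (Vsum j)
                          * (ι (Nsum j) + t j))

  coeff : (q r : ℕ) → (Fin r → Fin (suc q) → Carrier) → (Fin q → Carrier)
        → (Fin r → ℕ) → Carrier
  coeff q r x t n = ΣL (map (term q r x t n) (chainTuples q r n))

  -- formal power series in X_1..X_r, given by their (ordinary) coefficients
  PowerSeries : ℕ → Set c
  PowerSeries r = (Fin r → ℕ) → Carrier

  -- exponential generating function f = Σ c(n) X^n / n!
  genFun : (q r : ℕ) → (Fin r → Fin (suc q) → Carrier) → (Fin q → Carrier)
         → PowerSeries r
  genFun q r x t n = coeff q r x t n * (ΠF r (λ i → ι (n i !ℕ)) ⁻¹)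

  ∂ : {r : ℕ} → Fin r → PowerSeries r → PowerSeries r
  ∂ i G n = ι (suc (n i)) * G (bump n i)

  operator : {r m : ℕ} → (Fin m → Fin r) → Carrier → PowerSeries r → PowerSeries r
  operator {m = m} is a G n = ΣF m (λ k → ∂ (is k) G n) - a * G n

  IsZero : {r : ℕ} → PowerSeries r → Set ℓ
  IsZero G = ∀ n → G n ≈ 0#

module FieldStuff {c ℓ : Level} (F : Field c ℓ) where
  open Field F public using (Carrier; _≈_; _+_; _*_; -_; _-_; 0#; 1#; _⁻¹)
  open FieldDefs F public
  open CoeffDefs F public

{-# OPTIONS --safe #-}
module Submission where

-- Grouping the chains by their second entries m_i = n_{i2} turns the defining sum into the recursion
--   c^{t_1,…}_x(n) = Σ_{m ≤ n} Π_i C(n_i, m_i) x_{i1}^{n_i − m_i} · B(|n| − |m| + 1, |m| + t_1) · c^{t_2,…}_{x′}(m),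
-- where B is Euler's Beta function and x′_i drops the first entry of x_i; for p = 1 the coefficient
-- is Π_i x_{i1}^{n_i}.  The binomial sum is multiplication by exp(Σ_i x_{i1} X_i), so by the Leibniz
-- rule Σ_k ∂_{i_k} acting on it yields the factor Σ_k x_{i_k 1} = c plus the operator acting inside,
-- where the shift |n| ↦ |n| + 1 of the Beta factor is absorbed by B(a, b) = B(a + 1, b) + B(a, b + 1).
-- Induction on p gives Σ_k c(n + e_{i_k}) = c · c(n), the coefficientwise form of the claim.

open import Defs
open import Level using (Level)
open import Data.Nat as ℕ using (ℕ; zero; suc; _≤_; _<_; z≤n; s≤s; _∸_)
  renaming (_+_ to _+ℕ_; _*_ to _*ℕ_; _! to _!ℕ)
import Data.Nat.Properties as ℕ
open import Data.Nat.Combinatorics using (_C_; nCk≡n!/k![n-k]!; k>n⇒nCk≡0; k![n∸k]!∣n!; nCk+nC[k+1]≡[n+1]C[k+1])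
open import Data.Nat.DivMod using (m/n*n≡m)
open import Data.Fin using (Fin; zero; suc; inject₁; _≟_)
import Data.Fin.Properties as Fin
open import Data.Vec using (Vec; []; _∷_; lookup; head)
open import Data.List using (List; []; _∷_; map; concatMap; applyUpTo; upTo; _++_)
import Data.List.Properties as List
open import Data.List.Relation.Unary.All using (All; []; _∷_; universal)
import Data.List.Relation.Unary.All.Properties as All
open import Data.Empty using (⊥-elim)
open import Function.Definitions using (Injective)
open import Relation.Nullary using (¬_; Dec; yes; no)
open import Relation.Binary.PropositionalEquality as ≡ using (_≡_; _≗_)

module FieldProperties {c ℓ : Level} (K : Field c ℓ) where
  open Field K hiding (zero)
  open FieldDefs K using (ι)
  open import Relation.Binary.Reasoning.Setoid setoid
  open import Algebra.Solver.Ring.NaturalCoefficients.Default commutativeSemiring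

  1≉0 : 1# ≉ 0#
  1≉0 1≈0 = 0≉1 (sym 1≈0)

  ⁻¹-inverseʳ : ∀ {x} → x ≉ 0# → x * x ⁻¹ ≈ 1#
  ⁻¹-inverseʳ {x} = ⁻¹-inverse x

  ⁻¹-inverseˡ : ∀ {x} → x ≉ 0# → x ⁻¹ * x ≈ 1#
  ⁻¹-inverseˡ x≉0 = trans (*-comm _ _) (⁻¹-inverseʳ x≉0)

  *-cancelʳ-≉0 : ∀ {x y} → y ≉ 0# → x * y ≈ 0# → x ≈ 0#
  *-cancelʳ-≉0 {x} {y} y≉0 xy≈0 = begin
    x                ≈⟨ sym (*-identityʳ x) ⟩
    x * 1#           ≈⟨ *-congˡ (sym (⁻¹-inverseʳ y≉0)) ⟩
    x * (y * y ⁻¹)   ≈⟨ sym (*-assoc x y (y ⁻¹)) ⟩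
    (x * y) * y ⁻¹   ≈⟨ *-congʳ xy≈0 ⟩
    0# * y ⁻¹        ≈⟨ zeroˡ _ ⟩
    0#               ∎

  *-≉0 : ∀ {x y} → x ≉ 0# → y ≉ 0# → x * y ≉ 0#
  *-≉0 x≉0 y≉0 xy≈0 = x≉0 (*-cancelʳ-≉0 y≉0 xy≈0)

  ⁻¹-unique : ∀ {x y} → x * y ≈ 1# → y ≈ x ⁻¹
  ⁻¹-unique {x} {y} xy≈1 = begin
    y                ≈⟨ sym (*-identityʳ y) ⟩
    y * 1#           ≈⟨ *-congˡ (sym (⁻¹-inverseʳ x≉0)) ⟩
    y * (x * x ⁻¹)   ≈⟨ sym (*-assoc y x (x ⁻¹)) ⟩
    (y * x) * x ⁻¹   ≈⟨ *-congʳ (trans (*-comm y x) xy≈1) ⟩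
    1# * x ⁻¹        ≈⟨ *-identityˡ _ ⟩
    x ⁻¹             ∎
    where
    x≉0 : x ≉ 0#
    x≉0 x≈0 = 1≉0 (trans (sym xy≈1) (trans (*-congʳ x≈0) (zeroˡ y)))

  ⁻¹-≉0 : ∀ {x} → x ≉ 0# → x ⁻¹ ≉ 0#
  ⁻¹-≉0 {x} x≉0 x⁻¹≈0 = 1≉0 (trans (sym (⁻¹-inverseʳ x≉0)) (trans (*-congˡ x⁻¹≈0) (zeroʳ x)))

  ⁻¹-cong : ∀ {x y} → x ≉ 0# → x ≈ y → x ⁻¹ ≈ y ⁻¹
  ⁻¹-cong x≉0 x≈y = ⁻¹-unique (trans (*-congʳ (sym x≈y)) (⁻¹-inverseʳ x≉0))

  ⁻¹-involutive : ∀ {x} → x ≉ 0# → x ⁻¹ ⁻¹ ≈ x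
  ⁻¹-involutive x≉0 = sym (⁻¹-unique (⁻¹-inverseˡ x≉0))

  1⁻¹≈1 : 1# ⁻¹ ≈ 1#
  1⁻¹≈1 = sym (⁻¹-unique (*-identityˡ 1#))

  ⁻¹-distrib-* : ∀ {x y} → x ≉ 0# → y ≉ 0# → (x * y) ⁻¹ ≈ x ⁻¹ * y ⁻¹
  ⁻¹-distrib-* {x} {y} x≉0 y≉0 = sym (⁻¹-unique (begin
    (x * y) * (x ⁻¹ * y ⁻¹)
      ≈⟨ solve 4 (λ a b a' b' → (a :* b) :* (a' :* b') := (a :* a') :* (b :* b')) refl x y (x ⁻¹) (y ⁻¹) ⟩
    (x * x ⁻¹) * (y * y ⁻¹)  ≈⟨ *-cong (⁻¹-inverseʳ x≉0) (⁻¹-inverseʳ y≉0) ⟩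
    1# * 1#                  ≈⟨ *-identityˡ 1# ⟩
    1#                       ∎))

  *-⁻¹-cancel : ∀ {u x y} → u ≉ 0# → y ≉ 0# → (u * x) * (u * y) ⁻¹ ≈ x * y ⁻¹
  *-⁻¹-cancel {u} {x} {y} u≉0 y≉0 = begin
    (u * x) * (u * y) ⁻¹        ≈⟨ *-congˡ (⁻¹-distrib-* u≉0 y≉0) ⟩
    (u * x) * (u ⁻¹ * y ⁻¹)
      ≈⟨ solve 4 (λ a b a' b' → (a :* b) :* (a' :* b') := (b :* b') :* (a :* a')) refl u x (u ⁻¹) (y ⁻¹) ⟩
    (x * y ⁻¹) * (u * u ⁻¹)     ≈⟨ *-congˡ (⁻¹-inverseʳ u≉0) ⟩
    (x * y ⁻¹) * 1#             ≈⟨ *-identityʳ _ ⟩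
    x * y ⁻¹                    ∎

  ι-+ : ∀ m n → ι (m +ℕ n) ≈ ι m + ι n
  ι-+ zero    n = sym (+-identityˡ _)
  ι-+ (suc m) n = trans (+-congˡ (ι-+ m n)) (sym (+-assoc _ _ _))

  ι-* : ∀ m n → ι (m *ℕ n) ≈ ι m * ι n
  ι-* zero    n = sym (zeroˡ _)
  ι-* (suc m) n = begin
    ι (n +ℕ m *ℕ n)     ≈⟨ ι-+ n (m *ℕ n) ⟩
    ι n + ι (m *ℕ n)    ≈⟨ +-congˡ (ι-* m n) ⟩
    ι n + ι m * ι n     ≈⟨ solve 2 (λ a b → a :+ b :* a := (con 1 :+ b) :* a) refl (ι n) (ι m) ⟩
    (1# + ι m) * ι n    ∎

  ι-!-suc : ∀ n → ι (suc n !ℕ) ≈ ι (suc n) * ι (n !ℕ)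
  ι-!-suc n = ι-* (suc n) (n !ℕ)

module FiniteSums {c ℓ : Level} (K : Field c ℓ) where
  open FieldDefs K
  open Field K hiding (zero)
  open FieldProperties K using (1≉0; *-≉0)
  open import Relation.Binary.Reasoning.Setoid setoid
  open import Algebra.Solver.Ring.NaturalCoefficients.Default commutativeSemiring

  private
    +-interchange : ∀ a b c d → (a + b) + (c + d) ≈ (a + c) + (b + d)
    +-interchange = solve 4 (λ a b c d → (a :+ b) :+ (c :+ d) := (a :+ c) :+ (b :+ d)) refl

  ΣF-cong : ∀ n {f g : Fin n → Carrier} → (∀ i → f i ≈ g i) → ΣF n f ≈ ΣF n g
  ΣF-cong zero    f≈g = refl
  ΣF-cong (suc n) f≈g = +-cong (f≈g zero) (ΣF-cong n (λ i → f≈g (suc i)))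

  ΣF-distrib-+ : ∀ n (f g : Fin n → Carrier) → ΣF n (λ i → f i + g i) ≈ ΣF n f + ΣF n g
  ΣF-distrib-+ zero    f g = sym (+-identityˡ 0#)
  ΣF-distrib-+ (suc n) f g =
    trans (+-congˡ (ΣF-distrib-+ n _ _)) (+-interchange (f zero) (g zero) _ _)

  ΣF-*ˡ : ∀ n k (f : Fin n → Carrier) → ΣF n (λ i → k * f i) ≈ k * ΣF n f
  ΣF-*ˡ zero    k f = sym (zeroʳ k)
  ΣF-*ˡ (suc n) k f = trans (+-congˡ (ΣF-*ˡ n k _)) (sym (distribˡ k _ _))

  ΣF-*ʳ : ∀ n k (f : Fin n → Carrier) → ΣF n (λ i → f i * k) ≈ ΣF n f * k
  ΣF-*ʳ zero    k f = sym (zeroˡ k)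
  ΣF-*ʳ (suc n) k f = trans (+-congˡ (ΣF-*ʳ n k _)) (sym (distribʳ k _ _))

  ΠF-cong : ∀ n {f g : Fin n → Carrier} → (∀ i → f i ≈ g i) → ΠF n f ≈ ΠF n g
  ΠF-cong zero    f≈g = refl
  ΠF-cong (suc n) f≈g = *-cong (f≈g zero) (ΠF-cong n (λ i → f≈g (suc i)))

  ΠF-distrib-* : ∀ n (f g : Fin n → Carrier) → ΠF n (λ i → f i * g i) ≈ ΠF n f * ΠF n g
  ΠF-distrib-* zero    f g = sym (*-identityˡ 1#)
  ΠF-distrib-* (suc n) f g = trans (*-congˡ (ΠF-distrib-* n _ _))
    (solve 4 (λ a b c d → (a :* b) :* (c :* d) := (a :* c) :* (b :* d)) refl (f zero) (g zero) _ _)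

  ΠF-≉0 : ∀ n {f : Fin n → Carrier} → (∀ i → f i ≉ 0#) → ΠF n f ≉ 0#
  ΠF-≉0 zero    f≉0 = 1≉0
  ΠF-≉0 (suc n) f≉0 = *-≉0 (f≉0 zero) (ΠF-≉0 n (λ i → f≉0 (suc i)))

  sumℕ-cong : ∀ n {f g : Fin n → ℕ} → f ≗ g → sumℕ n f ≡ sumℕ n g
  sumℕ-cong zero    f≗g = ≡.refl
  sumℕ-cong (suc n) f≗g = ≡.cong₂ _+ℕ_ (f≗g zero) (sumℕ-cong n (λ i → f≗g (suc i)))

  sumℕ-mono-≤ : ∀ n {f g : Fin n → ℕ} → (∀ i → f i ≤ g i) → sumℕ n f ≤ sumℕ n g
  sumℕ-mono-≤ zero    f≤g = z≤n
  sumℕ-mono-≤ (suc n) f≤g = ℕ.+-mono-≤ (f≤g zero) (sumℕ-mono-≤ n (λ i → f≤g (suc i)))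

  sumℕ-∸ : ∀ n (f g : Fin n → ℕ) → (∀ i → g i ≤ f i) →
           sumℕ n (λ i → f i ∸ g i) ≡ sumℕ n f ∸ sumℕ n g
  sumℕ-∸ zero    f g g≤f = ≡.refl
  sumℕ-∸ (suc n) f g g≤f = ≡.trans
    (≡.cong (f zero ∸ g zero +ℕ_) (sumℕ-∸ n _ _ (λ i → g≤f (suc i))))
    (∸-+-∸ (g≤f zero) (sumℕ-mono-≤ n (λ i → g≤f (suc i))))
    where
    ∸-+-∸ : ∀ {a b x y} → b ≤ a → y ≤ x → (a ∸ b) +ℕ (x ∸ y) ≡ (a +ℕ x) ∸ (b +ℕ y)
    ∸-+-∸ {a} {b} {x} {y} b≤a y≤x = ≡.sym (≡.trans (≡.sym (ℕ.∸-+-assoc (a +ℕ x) b y))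
      (≡.trans (≡.cong (_∸ y) (ℕ.+-∸-comm x b≤a)) (ℕ.+-∸-assoc (a ∸ b) y≤x)))

  ΣL-++ : ∀ xs ys → ΣL (xs ++ ys) ≈ ΣL xs + ΣL ys
  ΣL-++ []       ys = sym (+-identityˡ _)
  ΣL-++ (x ∷ xs) ys = trans (+-congˡ (ΣL-++ xs ys)) (sym (+-assoc _ _ _))

  module _ {a} {A : Set a} where

    ΣL-map-cong : ∀ (xs : List A) {f g : A → Carrier} → (∀ x → f x ≈ g x) →
                  ΣL (map f xs) ≈ ΣL (map g xs)
    ΣL-map-cong []       f≈g = refl
    ΣL-map-cong (x ∷ xs) f≈g = +-cong (f≈g x) (ΣL-map-cong xs f≈g)

    ΣL-map-cong-All : ∀ {p} {P : A → Set p} {xs : List A} {f g : A → Carrier} →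
                      All P xs → (∀ x → P x → f x ≈ g x) → ΣL (map f xs) ≈ ΣL (map g xs)
    ΣL-map-cong-All []         f≈g = refl
    ΣL-map-cong-All (px ∷ pxs) f≈g = +-cong (f≈g _ px) (ΣL-map-cong-All pxs f≈g)

    ΣL-*ˡ : ∀ (xs : List A) k (f : A → Carrier) → ΣL (map (λ x → k * f x) xs) ≈ k * ΣL (map f xs)
    ΣL-*ˡ []       k f = sym (zeroʳ k)
    ΣL-*ˡ (x ∷ xs) k f = trans (+-congˡ (ΣL-*ˡ xs k f)) (sym (distribˡ k _ _))

    ΣL-distrib-+ : ∀ (xs : List A) (f g : A → Carrier) →
                   ΣL (map (λ x → f x + g x) xs) ≈ ΣL (map f xs) + ΣL (map g xs)
    ΣL-distrib-+ []       f g = sym (+-identityˡ 0#)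
    ΣL-distrib-+ (x ∷ xs) f g = trans (+-congˡ (ΣL-distrib-+ xs f g)) (+-interchange (f x) (g x) _ _)

    ΣL-map-∘ : ∀ {b} {B : Set b} (xs : List A) (f : A → B) (g : B → Carrier) →
               ΣL (map g (map f xs)) ≈ ΣL (map (λ x → g (f x)) xs)
    ΣL-map-∘ xs f g = reflexive (≡.cong ΣL (≡.sym (List.map-∘ xs)))

    ΣL-concatMap : ∀ {b} {B : Set b} (xs : List A) (F : A → List B) (g : B → Carrier) →
                   ΣL (map g (concatMap F xs)) ≈ ΣL (map (λ x → ΣL (map g (F x))) xs)
    ΣL-concatMap []       F g = refl
    ΣL-concatMap (x ∷ xs) F g = begin
      ΣL (map g (F x ++ concatMap F xs))                ≡⟨ ≡.cong ΣL (List.map-++ g (F x) _) ⟩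
      ΣL (map g (F x) ++ map g (concatMap F xs))        ≈⟨ ΣL-++ (map g (F x)) _ ⟩
      ΣL (map g (F x)) + ΣL (map g (concatMap F xs))    ≈⟨ +-congˡ (ΣL-concatMap xs F g) ⟩
      ΣL (map g (F x)) + ΣL (map (λ y → ΣL (map g (F y))) xs) ∎

  Σ≤ : ℕ → (ℕ → Carrier) → Carrier
  Σ≤ zero    f = f 0
  Σ≤ (suc n) f = f 0 + Σ≤ n (λ k → f (suc k))

  Σ≤-cong : ∀ n {f g : ℕ → Carrier} → (∀ k → k ≤ n → f k ≈ g k) → Σ≤ n f ≈ Σ≤ n g
  Σ≤-cong zero    f≈g = f≈g 0 z≤n
  Σ≤-cong (suc n) f≈g = +-cong (f≈g 0 z≤n) (Σ≤-cong n (λ k k≤n → f≈g (suc k) (s≤s k≤n)))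

  Σ≤-distrib-+ : ∀ n (f g : ℕ → Carrier) → Σ≤ n (λ k → f k + g k) ≈ Σ≤ n f + Σ≤ n g
  Σ≤-distrib-+ zero    f g = refl
  Σ≤-distrib-+ (suc n) f g = trans (+-congˡ (Σ≤-distrib-+ n _ _)) (+-interchange (f 0) (g 0) _ _)

  Σ≤-*ˡ : ∀ n k (f : ℕ → Carrier) → Σ≤ n (λ i → k * f i) ≈ k * Σ≤ n f
  Σ≤-*ˡ zero    k f = refl
  Σ≤-*ˡ (suc n) k f = trans (+-congˡ (Σ≤-*ˡ n k _)) (sym (distribˡ k _ _))

  Σ≤-shift : ∀ n (f : ℕ → Carrier) → f (suc n) ≈ 0# → Σ≤ n f ≈ f 0 + Σ≤ n (λ k → f (suc k))
  Σ≤-shift zero    f f[1]≈0 = sym (trans (+-congˡ f[1]≈0) (+-identityʳ _))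
  Σ≤-shift (suc n) f f[n+2]≈0 = +-congˡ (Σ≤-shift n (λ k → f (suc k)) f[n+2]≈0)

  ΣL-upTo : ∀ n (f : ℕ → Carrier) → ΣL (map f (upTo (suc n))) ≈ Σ≤ n f
  ΣL-upTo n f = ΣL-applyUpTo n (λ k → k)
    where
    ΣL-applyUpTo : ∀ n (g : ℕ → ℕ) → ΣL (map f (applyUpTo g (suc n))) ≈ Σ≤ n (λ k → f (g k))
    ΣL-applyUpTo zero    g = +-identityʳ _
    ΣL-applyUpTo (suc n) g = +-congˡ (ΣL-applyUpTo n (λ k → g (suc k)))

  Σ≤-ΣL : ∀ {a} {A : Set a} n (xs : List A) (F : A → ℕ → Carrier) →
          Σ≤ n (λ k → ΣL (map (λ x → F x k) xs)) ≈ ΣL (map (λ x → Σ≤ n (F x)) xs)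
  Σ≤-ΣL zero    xs F = refl
  Σ≤-ΣL (suc n) xs F =
    trans (+-congˡ (Σ≤-ΣL n xs (λ x k → F x (suc k)))) (sym (ΣL-distrib-+ xs _ _))

  Σ≤-ΣF : ∀ n m (F : Fin m → ℕ → Carrier) →
          Σ≤ n (λ k → ΣF m (λ i → F i k)) ≈ ΣF m (λ i → Σ≤ n (F i))
  Σ≤-ΣF zero    m F = refl
  Σ≤-ΣF (suc n) m F =
    trans (+-congˡ (Σ≤-ΣF n m (λ i k → F i (suc k)))) (sym (ΣF-distrib-+ m _ _))

  Extensional : ∀ {r} {A : Set} → ((Fin r → A) → Carrier) → Set ℓ
  Extensional h = ∀ {m m′} → m ≗ m′ → h m ≈ h m′

  Σbox : (r : ℕ) → (Fin r → ℕ) → ((Fin r → ℕ) → Carrier) → Carrier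
  Σbox zero    n h = h (λ ())
  Σbox (suc r) n h = Σ≤ (n zero) (λ m₀ → Σbox r (λ i → n (suc i)) (λ m → h (consF m₀ m)))

  Σbox-cong : ∀ r n {h h′ : (Fin r → ℕ) → Carrier} →
              (∀ m → (∀ i → m i ≤ n i) → h m ≈ h′ m) → Σbox r n h ≈ Σbox r n h′
  Σbox-cong zero    n h≈h′ = h≈h′ (λ ()) (λ ())
  Σbox-cong (suc r) n h≈h′ = Σ≤-cong (n zero) λ m₀ m₀≤ → Σbox-cong r (λ i → n (suc i)) λ m m≤ →
    h≈h′ (consF m₀ m) λ { zero → m₀≤ ; (suc i) → m≤ i }

  Σbox-cong-bounds : ∀ r {n n′} (h : (Fin r → ℕ) → Carrier) → n ≗ n′ → Σbox r n h ≈ Σbox r n′ h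
  Σbox-cong-bounds zero    h n≗n′ = refl
  Σbox-cong-bounds (suc r) {n} {n′} h n≗n′ = begin
    Σ≤ (n zero) (λ m₀ → Σbox r (λ i → n (suc i)) (λ m → h (consF m₀ m)))
      ≡⟨ ≡.cong (λ z → Σ≤ z _) (n≗n′ zero) ⟩
    Σ≤ (n′ zero) (λ m₀ → Σbox r (λ i → n (suc i)) (λ m → h (consF m₀ m)))
      ≈⟨ Σ≤-cong (n′ zero) (λ m₀ _ → Σbox-cong-bounds r _ (λ i → n≗n′ (suc i))) ⟩
    Σ≤ (n′ zero) (λ m₀ → Σbox r (λ i → n′ (suc i)) (λ m → h (consF m₀ m))) ∎

  Σbox-distrib-+ : ∀ r n (f g : (Fin r → ℕ) → Carrier) →
                   Σbox r n (λ m → f m + g m) ≈ Σbox r n f + Σbox r n g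
  Σbox-distrib-+ zero    n f g = refl
  Σbox-distrib-+ (suc r) n f g =
    trans (Σ≤-cong (n zero) (λ _ _ → Σbox-distrib-+ r _ _ _)) (Σ≤-distrib-+ (n zero) _ _)

  Σbox-*ˡ : ∀ r n k (f : (Fin r → ℕ) → Carrier) → Σbox r n (λ m → k * f m) ≈ k * Σbox r n f
  Σbox-*ˡ zero    n k f = refl
  Σbox-*ˡ (suc r) n k f = trans (Σ≤-cong (n zero) (λ _ _ → Σbox-*ˡ r _ k _)) (Σ≤-*ˡ (n zero) k _)

  Σbox-ΣL : ∀ {a} {A : Set a} r n (xs : List A) (F : A → (Fin r → ℕ) → Carrier) →
            Σbox r n (λ m → ΣL (map (λ x → F x m) xs)) ≈ ΣL (map (λ x → Σbox r n (F x)) xs)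
  Σbox-ΣL zero    n xs F = refl
  Σbox-ΣL (suc r) n xs F = trans (Σ≤-cong (n zero) (λ _ _ → Σbox-ΣL r _ xs _)) (Σ≤-ΣL (n zero) xs _)

  Σbox-ΣF : ∀ r n m (F : Fin m → (Fin r → ℕ) → Carrier) →
            Σbox r n (λ k → ΣF m (λ i → F i k)) ≈ ΣF m (λ i → Σbox r n (F i))
  Σbox-ΣF zero    n m F = refl
  Σbox-ΣF (suc r) n m F = trans (Σ≤-cong (n zero) (λ _ _ → Σbox-ΣF r _ m _)) (Σ≤-ΣF (n zero) m _)

module Binomial {c ℓ : Level} (K : Field c ℓ) where
  open FieldDefs K
  open Field K hiding (zero)
  open FieldProperties K using (ι-+)
  open FiniteSums K
  open import Relation.Binary.Reasoning.Setoid setoid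
  open import Algebra.Solver.Ring.NaturalCoefficients.Default commutativeSemiring

  binomialTerm : Carrier → ℕ → ℕ → Carrier
  binomialTerm y n m = ι (n C m) * y ^ (n ∸ m)

  binomialTerm-vanishes : ∀ y {n m} → n < m → binomialTerm y n m ≈ 0#
  binomialTerm-vanishes y {n} {m} n<m = trans (*-congʳ (reflexive (≡.cong ι (k>n⇒nCk≡0 n<m)))) (zeroˡ _)

  binomialTerm-zero : ∀ y n → binomialTerm y (suc n) 0 ≈ y * binomialTerm y n 0
  binomialTerm-zero y n = solve 2 (λ y yⁿ → (con 1 :+ con 0) :* (y :* yⁿ) := y :* ((con 1 :+ con 0) :* yⁿ))
    refl y (y ^ n)

  binomialTerm-pascal : ∀ y n m →
    binomialTerm y (suc n) (suc m) ≈ binomialTerm y n m + y * binomialTerm y n (suc m)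
  binomialTerm-pascal y n m = begin
    ι (suc n C suc m) * y ^ (n ∸ m)
      ≈⟨ *-congʳ (reflexive (≡.cong ι (≡.sym (nCk+nC[k+1]≡[n+1]C[k+1] n m)))) ⟩
    ι (n C m +ℕ n C suc m) * y ^ (n ∸ m)
      ≈⟨ trans (*-congʳ (ι-+ (n C m) _)) (distribʳ _ _ _) ⟩
    binomialTerm y n m + ι (n C suc m) * y ^ (n ∸ m)
      ≈⟨ +-congˡ (lower-power (suc m ℕ.≤? n)) ⟩
    binomialTerm y n m + y * binomialTerm y n (suc m) ∎
    where
    lower-power : Dec (suc m ≤ n) →
                  ι (n C suc m) * y ^ (n ∸ m) ≈ y * binomialTerm y n (suc m)
    lower-power (yes m<n) = begin
      ι (n C suc m) * y ^ (n ∸ m)           ≡⟨ ≡.cong (λ e → ι (n C suc m) * y ^ e) (ℕ.+-∸-assoc 1 m<n) ⟩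
      ι (n C suc m) * (y * y ^ (n ∸ suc m)) ≈⟨ solve 3 (λ c y z → c :* (y :* z) := y :* (c :* z)) refl _ y _ ⟩
      y * binomialTerm y n (suc m)           ∎
    lower-power (no m≮n) = begin
      ι (n C suc m) * y ^ (n ∸ m)   ≈⟨ trans (*-congʳ (reflexive (≡.cong ι (k>n⇒nCk≡0 n<1+m)))) (zeroˡ _) ⟩
      0#                            ≈⟨ sym (trans (*-congˡ (binomialTerm-vanishes y n<1+m)) (zeroʳ y)) ⟩
      y * binomialTerm y n (suc m)  ∎
      where n<1+m = ℕ.≰⇒> m≮n

  Σ≤-binomial-suc : ∀ y n (g : ℕ → Carrier) →
    Σ≤ (suc n) (λ m → binomialTerm y (suc n) m * g m) ≈
      y * Σ≤ n (λ m → binomialTerm y n m * g m) + Σ≤ n (λ m → binomialTerm y n m * g (suc m))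
  Σ≤-binomial-suc y n g = begin
    binomialTerm y (suc n) 0 * g 0 + Σ≤ n (λ m → binomialTerm y (suc n) (suc m) * g (suc m))
      ≈⟨ +-cong (*-congʳ (binomialTerm-zero y n))
                (trans (Σ≤-cong n (λ m _ → trans (*-congʳ (binomialTerm-pascal y n m)) (distribʳ _ _ _)))
                       (Σ≤-distrib-+ n _ _)) ⟩
    (y * w 0) * g 0 + (B + Σ≤ n (λ m → (y * w (suc m)) * g (suc m)))
      ≈⟨ +-congˡ (+-congˡ (trans (Σ≤-cong n (λ m _ → *-assoc _ _ _)) (Σ≤-*ˡ n y _))) ⟩
    (y * w 0) * g 0 + (B + y * Σ≤ n (λ m → F (suc m)))
      ≈⟨ solve 5 (λ y w₀ g₀ b s → (y :* w₀) :* g₀ :+ (b :+ y :* s) := y :* (w₀ :* g₀ :+ s) :+ b)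
           refl y (w 0) (g 0) B _ ⟩
    y * (F 0 + Σ≤ n (λ m → F (suc m))) + B
      ≈⟨ +-congʳ (*-congˡ (sym (Σ≤-shift n F F[n+1]≈0))) ⟩
    y * Σ≤ n F + B ∎
    where
    w = binomialTerm y n
    F : ℕ → Carrier
    F m = w m * g m
    B = Σ≤ n (λ m → w m * g (suc m))
    F[n+1]≈0 : F (suc n) ≈ 0#
    F[n+1]≈0 = trans (*-congʳ (binomialTerm-vanishes y (ℕ.n<1+n n))) (zeroˡ _)

  bump-suc-suc : ∀ {r} (n : Fin (suc r) → ℕ) i k → bump n (suc i) (suc k) ≡ bump (λ j → n (suc j)) i k
  bump-suc-suc n i k with k ≟ i | suc k ≟ suc i
  ... | yes _   | yes _   = ≡.refl
  ... | no _    | no _    = ≡.refl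
  ... | yes k≡i | no k≢i  = ⊥-elim (k≢i (≡.cong suc k≡i))
  ... | no k≢i  | yes k≡i = ⊥-elim (k≢i (Fin.suc-injective k≡i))

  sumℕ-bump : ∀ r (n : Fin r → ℕ) i → sumℕ r (bump n i) ≡ suc (sumℕ r n)
  sumℕ-bump (suc r) n zero    = ≡.refl
  sumℕ-bump (suc r) n (suc i) = ≡.trans
    (≡.cong (n zero +ℕ_) (≡.trans (sumℕ-cong r (bump-suc-suc n i)) (sumℕ-bump r (λ j → n (suc j)) i)))
    (ℕ.+-suc (n zero) _)

  ΠF-bump : ∀ r (f : Fin r → ℕ → Carrier) (n : Fin r → ℕ) i u →
            f i (suc (n i)) ≈ u * f i (n i) →
            ΠF r (λ k → f k (bump n i k)) ≈ u * ΠF r (λ k → f k (n k))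
  ΠF-bump (suc r) f n zero    u f-step = trans (*-congʳ f-step) (*-assoc _ _ _)
  ΠF-bump (suc r) f n (suc i) u f-step = begin
    f zero (n zero) * ΠF r (λ k → f (suc k) (bump n (suc i) (suc k)))
      ≈⟨ *-congˡ (ΠF-cong r (λ k → reflexive (≡.cong (f (suc k)) (bump-suc-suc n i k)))) ⟩
    f zero (n zero) * ΠF r (λ k → f (suc k) (bump (λ j → n (suc j)) i k))
      ≈⟨ *-congˡ (ΠF-bump r (λ k → f (suc k)) (λ j → n (suc j)) i u f-step) ⟩
    f zero (n zero) * (u * ΠF r (λ k → f (suc k) (n (suc k))))
      ≈⟨ solve 3 (λ a u b → a :* (u :* b) := u :* (a :* b)) refl _ u _ ⟩
    u * ΠF (suc r) (λ k → f k (n k)) ∎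

  binomialWeight : (r : ℕ) → (Fin r → Carrier) → (Fin r → ℕ) → (Fin r → ℕ) → Carrier
  binomialWeight r y n m = ΠF r (λ i → binomialTerm (y i) (n i) (m i))

  -- binomialΣ r y n h is n! [Xⁿ] of exp(Σ_i y_i X_i) · Σ_m h m Xᵐ / m!,
  -- so binomialΣ-bump is the Leibniz rule for ∂_{X_i}.
  binomialΣ : (r : ℕ) → (Fin r → Carrier) → (Fin r → ℕ) → ((Fin r → ℕ) → Carrier) → Carrier
  binomialΣ r y n h = Σbox r n (λ m → binomialWeight r y n m * h m)

  module _ (r : ℕ) (y : Fin r → Carrier) (n : Fin r → ℕ) where

    binomialΣ-cong : ∀ {h h′ : (Fin r → ℕ) → Carrier} → (∀ m → (∀ i → m i ≤ n i) → h m ≈ h′ m) →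
                     binomialΣ r y n h ≈ binomialΣ r y n h′
    binomialΣ-cong h≈h′ = Σbox-cong r n (λ m m≤n → *-congˡ (h≈h′ m m≤n))

    binomialΣ-distrib-+ : ∀ (f g : (Fin r → ℕ) → Carrier) →
                          binomialΣ r y n (λ m → f m + g m) ≈ binomialΣ r y n f + binomialΣ r y n g
    binomialΣ-distrib-+ f g = trans (Σbox-cong r n (λ m _ → distribˡ _ _ _)) (Σbox-distrib-+ r n _ _)

    binomialΣ-*ˡ : ∀ k (f : (Fin r → ℕ) → Carrier) → binomialΣ r y n (λ m → k * f m) ≈ k * binomialΣ r y n f
    binomialΣ-*ˡ k f = trans (Σbox-cong r n (λ m _ → solve 3 (λ p k f → p :* (k :* f) := k :* (p :* f)) refl _ k _))
                             (Σbox-*ˡ r n k _)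

    binomialΣ-ΣF : ∀ l (F : Fin l → (Fin r → ℕ) → Carrier) →
                   binomialΣ r y n (λ m → ΣF l (λ k → F k m)) ≈ ΣF l (λ k → binomialΣ r y n (F k))
    binomialΣ-ΣF l F = trans (Σbox-cong r n (λ m _ → sym (ΣF-*ˡ l _ _))) (Σbox-ΣF r n l _)

  binomialΣ-cong-bounds : ∀ r y {n n′} (h : (Fin r → ℕ) → Carrier) → n ≗ n′ →
                          binomialΣ r y n h ≈ binomialΣ r y n′ h
  binomialΣ-cong-bounds r y {n} {n′} h n≗n′ = trans
    (Σbox-cong r n (λ m _ → *-congʳ (ΠF-cong r (λ i →
       reflexive (≡.cong (λ z → binomialTerm (y i) z (m i)) (n≗n′ i))))))
    (Σbox-cong-bounds r _ n≗n′)

  binomialΣ-suc : ∀ r y n (h : (Fin (suc r) → ℕ) → Carrier) →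
    binomialΣ (suc r) y n h ≈
      Σ≤ (n zero) (λ m₀ → binomialTerm (y zero) (n zero) m₀ *
                          binomialΣ r (λ i → y (suc i)) (λ i → n (suc i)) (λ m → h (consF m₀ m)))
  binomialΣ-suc r y n h = Σ≤-cong (n zero) (λ m₀ _ →
    trans (Σbox-cong r _ (λ m _ → *-assoc _ _ _)) (Σbox-*ˡ r _ _ _))

  binomialΣ-bump : ∀ r y n i (h : (Fin r → ℕ) → Carrier) → Extensional h →
    binomialΣ r y (bump n i) h ≈ y i * binomialΣ r y n h + binomialΣ r y n (λ m → h (bump m i))
  binomialΣ-bump (suc r) y n zero h h-ext = begin
    binomialΣ (suc r) y (bump n zero) h
      ≈⟨ binomialΣ-suc r y (bump n zero) h ⟩
    Σ≤ (suc n₀) (λ m₀ → binomialTerm y₀ (suc n₀) m₀ * G m₀)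
      ≈⟨ Σ≤-binomial-suc y₀ n₀ G ⟩
    y₀ * Σ≤ n₀ (λ m₀ → w m₀ * G m₀) + Σ≤ n₀ (λ m₀ → w m₀ * G (suc m₀))
      ≈⟨ +-cong (*-congˡ (sym (binomialΣ-suc r y n h)))
                (sym (trans (binomialΣ-suc r y n (λ m → h (bump m zero))) (Σ≤-cong n₀ (λ m₀ _ → *-congˡ
                   (binomialΣ-cong r y′ n′ (λ m _ → h-ext (λ { zero → ≡.refl ; (suc k) → ≡.refl }))))))) ⟩
    y₀ * binomialΣ (suc r) y n h + binomialΣ (suc r) y n (λ m → h (bump m zero)) ∎
    where
    n₀ = n zero
    y₀ = y zero
    n′ : Fin r → ℕ
    n′ i = n (suc i)
    y′ : Fin r → Carrier
    y′ i = y (suc i)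
    w = binomialTerm y₀ n₀
    G : ℕ → Carrier
    G m₀ = binomialΣ r y′ n′ (λ m → h (consF m₀ m))
  binomialΣ-bump (suc r) y n (suc i) h h-ext = begin
    binomialΣ (suc r) y (bump n (suc i)) h
      ≈⟨ binomialΣ-suc r y (bump n (suc i)) h ⟩
    Σ≤ n₀ (λ m₀ → w m₀ * binomialΣ r y′ (λ k → bump n (suc i) (suc k)) (h₀ m₀))
      ≈⟨ Σ≤-cong n₀ (λ m₀ _ → *-congˡ (trans (binomialΣ-cong-bounds r y′ (h₀ m₀) (bump-suc-suc n i))
           (binomialΣ-bump r y′ n′ i (h₀ m₀)
             (λ m≗m′ → h-ext (λ { zero → ≡.refl ; (suc k) → m≗m′ k }))))) ⟩
    Σ≤ n₀ (λ m₀ → w m₀ * (y′ i * A m₀ + B m₀))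
      ≈⟨ trans (Σ≤-cong n₀ (λ m₀ _ →
                 solve 4 (λ w y a b → w :* (y :* a :+ b) := y :* (w :* a) :+ w :* b) refl _ _ _ _))
               (trans (Σ≤-distrib-+ n₀ _ _) (+-congʳ (Σ≤-*ˡ n₀ _ _))) ⟩
    y′ i * Σ≤ n₀ (λ m₀ → w m₀ * A m₀) + Σ≤ n₀ (λ m₀ → w m₀ * B m₀)
      ≈⟨ +-cong (*-congˡ (sym (binomialΣ-suc r y n h)))
                (sym (trans (binomialΣ-suc r y n (λ m → h (bump m (suc i)))) (Σ≤-cong n₀ (λ m₀ _ → *-congˡ
                   (binomialΣ-cong r y′ n′ (λ m _ →
                      h-ext (λ { zero → ≡.refl ; (suc k) → bump-suc-suc (consF m₀ m) i k }))))))) ⟩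
    y (suc i) * binomialΣ (suc r) y n h + binomialΣ (suc r) y n (λ m → h (bump m (suc i))) ∎
    where
    n₀ = n zero
    n′ : Fin r → ℕ
    n′ i = n (suc i)
    y′ : Fin r → Carrier
    y′ i = y (suc i)
    w = binomialTerm (y zero) n₀
    h₀ : ℕ → (Fin r → ℕ) → Carrier
    h₀ m₀ m = h (consF m₀ m)
    A B : ℕ → Carrier
    A m₀ = binomialΣ r y′ n′ (h₀ m₀)
    B m₀ = binomialΣ r y′ n′ (λ m → h₀ m₀ (bump m i))

module Beta {c ℓ : Level} (K : Field c ℓ) where
  open FieldDefs K
  open Field K hiding (zero)
  open FieldProperties K
  open import Relation.Binary.Reasoning.Setoid setoid
  open import Algebra.Solver.Ring.NaturalCoefficients.Default commutativeSemiring

  NotNonPositiveInteger : Carrier → Set ℓ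
  NotNonPositiveInteger s = ∀ n → ¬ (s ≈ - ι n)

  ι+-≉0 : ∀ {s} → NotNonPositiveInteger s → ∀ k → ι k + s ≉ 0#
  ι+-≉0 {s} s∉-ℕ k k+s≈0 = s∉-ℕ k (begin
    s                   ≈⟨ sym (+-identityʳ s) ⟩
    s + 0#              ≈⟨ +-congˡ (sym (-‿inverseʳ (ι k))) ⟩
    s + (ι k + - ι k)   ≈⟨ solve 3 (λ s k k′ → s :+ (k :+ k′) := (k :+ s) :+ k′) refl s (ι k) (- ι k) ⟩
    (ι k + s) + - ι k   ≈⟨ +-congʳ k+s≈0 ⟩
    0# + - ι k          ≈⟨ +-identityˡ _ ⟩
    - ι k               ∎)

  -- (M + s)(M + 1 + s) ⋯ (M + V + s), with V + 1 factors
  rising : Carrier → ℕ → ℕ → Carrier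
  rising s M zero    = ι M + s
  rising s M (suc V) = (ι M + s) * rising s (suc M) V

  rising-≉0 : ∀ {s} → NotNonPositiveInteger s → ∀ M V → rising s M V ≉ 0#
  rising-≉0 s∉-ℕ M zero    = ι+-≉0 s∉-ℕ M
  rising-≉0 s∉-ℕ M (suc V) = *-≉0 (ι+-≉0 s∉-ℕ M) (rising-≉0 s∉-ℕ (suc M) V)

  rising-suc : ∀ s M V → rising s M (suc V) ≈ rising s M V * (ι (suc (M +ℕ V)) + s)
  rising-suc s M zero    = *-congˡ (reflexive (≡.cong (λ z → ι (suc z) + s) (≡.sym (ℕ.+-identityʳ M))))
  rising-suc s M (suc V) = trans (*-congˡ (rising-suc s (suc M) V))
    (trans (sym (*-assoc _ _ _)) (*-congˡ (reflexive (≡.cong (λ z → ι (suc z) + s) (≡.sym (ℕ.+-suc M V))))))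

  -- beta s N M = B(N − M + 1, M + s)
  beta : Carrier → ℕ → ℕ → Carrier
  beta s N M = ι ((N ∸ M) !ℕ) * rising s M (N ∸ M) ⁻¹

  private
    beta-recurrence-rising : ∀ {s} → NotNonPositiveInteger s → ∀ M V →
      ι (suc V !ℕ) * rising s M (suc V) ⁻¹ + ι (V !ℕ) * rising s (suc M) V ⁻¹ ≈ ι (V !ℕ) * rising s M V ⁻¹
    beta-recurrence-rising {s} s∉-ℕ M V = begin
      ι (suc V !ℕ) * (A * R) ⁻¹ + f * R ⁻¹
        ≈⟨ +-cong (*-cong (ι-!-suc V) (⁻¹-distrib-* A≉0 R≉0))
                  (sym (trans (*-congˡ (⁻¹-inverseʳ A≉0)) (*-identityʳ _))) ⟩
      (ι (suc V) * f) * (A ⁻¹ * R ⁻¹) + (f * R ⁻¹) * (A * A ⁻¹)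
        ≈⟨ solve 5 (λ v f a′ r′ a → (v :* f) :* (a′ :* r′) :+ (f :* r′) :* (a :* a′)
                                  := (f :* (a′ :* r′)) :* (v :+ a))
             refl (ι (suc V)) f (A ⁻¹) (R ⁻¹) A ⟩
      (f * (A ⁻¹ * R ⁻¹)) * (ι (suc V) + A)
        ≈⟨ *-cong (*-congˡ (sym (⁻¹-distrib-* A≉0 R≉0))) V+1+A≈B ⟩
      (f * (A * R) ⁻¹) * B
        ≈⟨ *-congʳ (*-congˡ (trans (⁻¹-cong (*-≉0 A≉0 R≉0) (rising-suc s M V)) (⁻¹-distrib-* P≉0 B≉0))) ⟩
      (f * (P ⁻¹ * B ⁻¹)) * B
        ≈⟨ solve 4 (λ f p′ b′ b → (f :* (p′ :* b′)) :* b := (f :* p′) :* (b :* b′))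
             refl f (P ⁻¹) (B ⁻¹) B ⟩
      (f * P ⁻¹) * (B * B ⁻¹)
        ≈⟨ trans (*-congˡ (⁻¹-inverseʳ B≉0)) (*-identityʳ _) ⟩
      f * P ⁻¹ ∎
      where
      f = ι (V !ℕ)
      A = ι M + s
      R = rising s (suc M) V
      P = rising s M V
      B = ι (suc (M +ℕ V)) + s
      A≉0 = ι+-≉0 s∉-ℕ M
      R≉0 = rising-≉0 s∉-ℕ (suc M) V
      P≉0 = rising-≉0 s∉-ℕ M V
      B≉0 = ι+-≉0 s∉-ℕ (suc (M +ℕ V))
      V+1+A≈B : ι (suc V) + A ≈ B
      V+1+A≈B = begin
        (1# + ι V) + (ι M + s)
          ≈⟨ solve 4 (λ o v m s → (o :+ v) :+ (m :+ s) := (o :+ (m :+ v)) :+ s) refl 1# (ι V) (ι M) s ⟩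
        (1# + (ι M + ι V)) + s   ≈⟨ +-congʳ (+-congˡ (sym (ι-+ M V))) ⟩
        B                        ∎

  beta-recurrence : ∀ {s} → NotNonPositiveInteger s → ∀ {N M} → M ≤ N →
                    beta s (suc N) M + beta s (suc N) (suc M) ≈ beta s N M
  beta-recurrence {s} s∉-ℕ {N} {M} M≤N = begin
    ι ((suc N ∸ M) !ℕ) * rising s M (suc N ∸ M) ⁻¹ + beta s (suc N) (suc M)
      ≡⟨ ≡.cong (λ z → ι (z !ℕ) * rising s M z ⁻¹ + beta s (suc N) (suc M)) (ℕ.+-∸-assoc 1 M≤N) ⟩
    ι (suc (N ∸ M) !ℕ) * rising s M (suc (N ∸ M)) ⁻¹ + ι ((N ∸ M) !ℕ) * rising s (suc M) (N ∸ M) ⁻¹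
      ≈⟨ beta-recurrence-rising s∉-ℕ M (N ∸ M) ⟩
    beta s N M ∎

module RecursiveCoefficients {c ℓ : Level} (K : Field c ℓ) where
  open FieldDefs K
  open Field K hiding (zero)
  open FiniteSums K
  open Binomial K
  open Beta K
  open import Relation.Binary.Reasoning.Setoid setoid
  open import Algebra.Solver.Ring.NaturalCoefficients.Default commutativeSemiring

  coeffRec : (q r : ℕ) → (Fin r → Fin (suc q) → Carrier) → (Fin q → Carrier) → (Fin r → ℕ) → Carrier
  coeffRec zero    r x t n = ΠF r (λ i → x i zero ^ n i)
  coeffRec (suc q) r x t n = binomialΣ r (λ i → x i zero) n (λ m →
    beta (t zero) (sumℕ r n) (sumℕ r m) * coeffRec q r (λ i j → x i (suc j)) (λ j → t (suc j)) m)

  coeffRec-cong : ∀ q r x t → Extensional (coeffRec q r x t)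
  coeffRec-cong zero    r x t n≗n′ = ΠF-cong r (λ i → reflexive (≡.cong (x i zero ^_) (n≗n′ i)))
  coeffRec-cong (suc q) r x t {n} {n′} n≗n′ = trans
    (binomialΣ-cong r _ n (λ m _ →
       *-congʳ (reflexive (≡.cong (λ N → beta (t zero) N (sumℕ r m)) (sumℕ-cong r n≗n′)))))
    (binomialΣ-cong-bounds r _ _ n≗n′)

  coeffRec-annihilated : ∀ q r {l} (is : Fin l → Fin r) (x : Fin r → Fin (suc q) → Carrier) t a →
    (∀ j → NotNonPositiveInteger (t j)) → (∀ j → ΣF l (λ k → x (is k) j) ≈ a) →
    ∀ n → ΣF l (λ k → coeffRec q r x t (bump n (is k))) ≈ a * coeffRec q r x t n
  coeffRec-annihilated zero r {l} is x t a _ Σx≈a n = begin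
    ΣF l (λ k → coeffRec zero r x t (bump n (is k)))
      ≈⟨ ΣF-cong l (λ k → ΠF-bump r (λ i e → x i zero ^ e) n (is k) (x (is k) zero) refl) ⟩
    ΣF l (λ k → x (is k) zero * coeffRec zero r x t n)   ≈⟨ ΣF-*ʳ l _ _ ⟩
    ΣF l (λ k → x (is k) zero) * coeffRec zero r x t n   ≈⟨ *-congʳ (Σx≈a zero) ⟩
    a * coeffRec zero r x t n ∎
  coeffRec-annihilated (suc q) r {l} is x t a t∉-ℕ Σx≈a n = begin
    ΣF l (λ k → coeffRec (suc q) r x t (bump n (is k)))
      ≈⟨ ΣF-cong l (λ k → bumped (is k)) ⟩
    ΣF l (λ k → x₀ (is k) * binomialΣ r x₀ n H + binomialΣ r x₀ n (λ m → H (bump m (is k))))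
      ≈⟨ trans (ΣF-distrib-+ l _ _)
               (+-cong (trans (ΣF-*ʳ l _ _) (*-congʳ (Σx≈a zero))) (sym (binomialΣ-ΣF r x₀ n l _))) ⟩
    a * binomialΣ r x₀ n H + binomialΣ r x₀ n (λ m → ΣF l (λ k → H (bump m (is k))))
      ≈⟨ +-congˡ (binomialΣ-cong r x₀ n (λ m _ → inner m)) ⟩
    a * binomialΣ r x₀ n H + binomialΣ r x₀ n (λ m → a * (beta s (suc N) (suc (sumℕ r m)) * C′ m))
      ≈⟨ trans (+-congˡ (binomialΣ-*ˡ r x₀ n a _)) (sym (distribˡ a _ _)) ⟩
    a * (binomialΣ r x₀ n H + binomialΣ r x₀ n (λ m → beta s (suc N) (suc (sumℕ r m)) * C′ m))
      ≈⟨ *-congˡ (trans (sym (binomialΣ-distrib-+ r x₀ n _ _)) (binomialΣ-cong r x₀ n (λ m m≤n →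
           trans (sym (distribʳ _ _ _)) (*-congʳ (beta-recurrence (t∉-ℕ zero) (sumℕ-mono-≤ r m≤n)))))) ⟩
    a * coeffRec (suc q) r x t n ∎
    where
    x₀ : Fin r → Carrier
    x₀ i = x i zero
    x′ : Fin r → Fin (suc q) → Carrier
    x′ i j = x i (suc j)
    t′ : Fin q → Carrier
    t′ j = t (suc j)
    s = t zero
    N = sumℕ r n
    C′ = coeffRec q r x′ t′
    H : (Fin r → ℕ) → Carrier
    H m = beta s (suc N) (sumℕ r m) * C′ m
    bumped : ∀ i → coeffRec (suc q) r x t (bump n i) ≈
                   x₀ i * binomialΣ r x₀ n H + binomialΣ r x₀ n (λ m → H (bump m i))
    bumped i = trans
      (binomialΣ-cong r x₀ (bump n i) (λ m _ →
         *-congʳ (reflexive (≡.cong (λ z → beta s z (sumℕ r m)) (sumℕ-bump r n i)))))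
      (binomialΣ-bump r x₀ n i H (λ m≗m′ →
         *-cong (reflexive (≡.cong (beta s (suc N)) (sumℕ-cong r m≗m′))) (coeffRec-cong q r x′ t′ m≗m′)))
    inner : ∀ m → ΣF l (λ k → H (bump m (is k))) ≈ a * (beta s (suc N) (suc (sumℕ r m)) * C′ m)
    inner m = begin
      ΣF l (λ k → H (bump m (is k)))
        ≈⟨ ΣF-cong l (λ k → *-congʳ (reflexive (≡.cong (beta s (suc N)) (sumℕ-bump r m (is k))))) ⟩
      ΣF l (λ k → beta s (suc N) (suc (sumℕ r m)) * C′ (bump m (is k)))
        ≈⟨ ΣF-*ˡ l _ _ ⟩
      beta s (suc N) (suc (sumℕ r m)) * ΣF l (λ k → C′ (bump m (is k)))
        ≈⟨ *-congˡ (coeffRec-annihilated q r is x′ t′ a (λ j → t∉-ℕ (suc j)) (λ j → Σx≈a (suc j)) m) ⟩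
      beta s (suc N) (suc (sumℕ r m)) * (a * C′ m)
        ≈⟨ solve 3 (λ b a c → b :* (a :* c) := a :* (b :* c)) refl _ a _ ⟩
      a * (beta s (suc N) (suc (sumℕ r m)) * C′ m) ∎

module Denominators {c ℓ : Level} (K : Field c ℓ) (char : FieldDefs.CharacteristicZero K) where
  open FieldDefs K
  open Field K hiding (zero)
  open FieldProperties K
  open Beta K
  open import Relation.Binary.Reasoning.Setoid setoid
  open import Algebra.Solver.Ring.NaturalCoefficients.Default commutativeSemiring

  ι-!-≉0 : ∀ n → ι (n !ℕ) ≉ 0#
  ι-!-≉0 zero    = char 0
  ι-!-≉0 (suc n) n+1!≈0 = *-≉0 (char n) (ι-!-≉0 n) (trans (sym (ι-!-suc n)) n+1!≈0)

  denominator : Carrier → ℕ → ℕ → Carrier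
  denominator s N V = binom (ι N + s - 1#) V * (ι N + s)

  fallingFactorial-rising : ∀ s M V →
    fallingFactorial (ι (M +ℕ V) + s - 1#) V * (ι (M +ℕ V) + s) ≈ rising s M V
  fallingFactorial-rising s M zero    =
    trans (*-identityˡ _) (reflexive (≡.cong (λ z → ι z + s) (ℕ.+-identityʳ M)))
  fallingFactorial-rising s M (suc V) = begin
    fallingFactorial (ι (M +ℕ suc V) + s - 1#) (suc V) * (ι (M +ℕ suc V) + s)
      ≡⟨ ≡.cong (λ z → fallingFactorial (ι z + s - 1#) (suc V) * (ι z + s)) (ℕ.+-suc M V) ⟩
    (fallingFactorial z V * (z - ι V)) * (ι (suc M +ℕ V) + s)
      ≈⟨ solve 3 (λ f z w → (f :* z) :* w := (f :* w) :* z) refl _ _ _ ⟩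
    (fallingFactorial z V * (ι (suc M +ℕ V) + s)) * (z - ι V)
      ≈⟨ *-cong (fallingFactorial-rising s (suc M) V) lowest-factor ⟩
    rising s (suc M) V * (ι M + s) ≈⟨ *-comm _ _ ⟩
    rising s M (suc V) ∎
    where
    z = ι (suc M +ℕ V) + s - 1#
    lowest-factor : z - ι V ≈ ι M + s
    lowest-factor = begin
      ((1# + ι (M +ℕ V)) + s) + - 1# + - ι V   ≈⟨ +-congʳ (+-congʳ (+-congʳ (+-congˡ (ι-+ M V)))) ⟩
      ((1# + (ι M + ι V)) + s) + - 1# + - ι V
        ≈⟨ solve 5 (λ m v s u w → ((con 1 :+ (m :+ v)) :+ s) :+ u :+ w := ((m :+ s) :+ (con 1 :+ u)) :+ (v :+ w))
             refl (ι M) (ι V) s (- 1#) (- ι V) ⟩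
      ((ι M + s) + (1# + - 1#)) + (ι V + - ι V) ≈⟨ +-cong (+-congˡ (-‿inverseʳ 1#)) (-‿inverseʳ (ι V)) ⟩
      ((ι M + s) + 0#) + 0#                      ≈⟨ trans (+-identityʳ _) (+-identityʳ _) ⟩
      ι M + s ∎

  denominator-rising : ∀ s M V → denominator s (M +ℕ V) V ≈ rising s M V * ι (V !ℕ) ⁻¹
  denominator-rising s M V = trans (solve 3 (λ f i w → (f :* i) :* w := (f :* w) :* i) refl _ _ _)
                                   (*-congʳ (fallingFactorial-rising s M V))

  denominator-≉0 : ∀ {s} → NotNonPositiveInteger s → ∀ {N V} → V ≤ N → denominator s N V ≉ 0#
  denominator-≉0 {s} s∉-ℕ {N} {V} V≤N = ≡.subst (λ Z → denominator s Z V ≉ 0#) (ℕ.m∸n+n≡m V≤N)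
    (λ d≈0 → *-≉0 (rising-≉0 s∉-ℕ (N ∸ V) V) (⁻¹-≉0 (ι-!-≉0 V))
                  (trans (sym (denominator-rising s (N ∸ V) V)) d≈0))

  denominator⁻¹-beta : ∀ {s} → NotNonPositiveInteger s → ∀ {N M} → M ≤ N →
                       denominator s N (N ∸ M) ⁻¹ ≈ beta s N M
  denominator⁻¹-beta {s} s∉-ℕ {N} {M} M≤N =
    ≡.subst (λ Z → denominator s Z (Z ∸ M) ⁻¹ ≈ beta s Z M) (ℕ.m+[n∸m]≡n M≤N) (begin
      denominator s (M +ℕ V) (M +ℕ V ∸ M) ⁻¹
        ≡⟨ ≡.cong (λ z → denominator s (M +ℕ V) z ⁻¹) (ℕ.m+n∸m≡n M V) ⟩
      denominator s (M +ℕ V) V ⁻¹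
        ≈⟨ ⁻¹-cong (denominator-≉0 s∉-ℕ (ℕ.m≤n+m V M)) (denominator-rising s M V) ⟩
      (rising s M V * ι (V !ℕ) ⁻¹) ⁻¹
        ≈⟨ ⁻¹-distrib-* (rising-≉0 s∉-ℕ M V) (⁻¹-≉0 (ι-!-≉0 V)) ⟩
      rising s M V ⁻¹ * ι (V !ℕ) ⁻¹ ⁻¹
        ≈⟨ trans (*-congˡ (⁻¹-involutive (ι-!-≉0 V))) (*-comm _ _) ⟩
      ι (V !ℕ) * rising s M V ⁻¹
        ≡⟨ ≡.cong (λ z → ι (z !ℕ) * rising s M z ⁻¹) (ℕ.m+n∸m≡n M V) ⟨
      beta s (M +ℕ V) M ∎)
    where V = N ∸ M

module Expansion {c ℓ : Level} (K : Field c ℓ) (char : FieldDefs.CharacteristicZero K) where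
  open FieldDefs K
  open CoeffDefs K
  open Field K hiding (zero)
  open FieldProperties K
  open FiniteSums K
  open Binomial K
  open Beta K
  open Denominators K char
  open RecursiveCoefficients K
  open import Relation.Binary.Reasoning.Setoid setoid
  open import Algebra.Solver.Ring.NaturalCoefficients.Default commutativeSemiring

  chains-head : ∀ q n → All (λ v → head v ≡ n) (chains q n)
  chains-head zero    n = ≡.refl ∷ []
  chains-head (suc q) n =
    All.concat⁺ (All.map⁺ {f = λ m → map (n ∷_) (chains q m)}
      (universal (λ m → All.map⁺ {f = n ∷_} (universal (λ _ → ≡.refl) (chains q m))) (upTo (suc n))))

  chainTuples-heads : ∀ q r m → All (λ M → ∀ i → head (M i) ≡ m i) (chainTuples q r m)
  chainTuples-heads q zero    m = (λ ()) ∷ []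
  chainTuples-heads q (suc r) m = All.concat⁺ (All.gmap⁺
    (λ head≡ → All.gmap⁺ (λ heads≡ → λ { zero → head≡ ; (suc i) → heads≡ i })
                         (chainTuples-heads q r (λ i → m (suc i))))
    (chains-head q (m zero)))

  ΣL-chainTuples-suc : ∀ q r n (g : (Fin (suc r) → Vec ℕ (suc q)) → Carrier) →
    ΣL (map g (chainTuples q (suc r) n)) ≈
      ΣL (map (λ ch → ΣL (map (λ M → g (consF ch M)) (chainTuples q r (λ i → n (suc i))))) (chains q (n zero)))
  ΣL-chainTuples-suc q r n g =
    trans (ΣL-concatMap (chains q (n zero)) _ g)
          (ΣL-map-cong (chains q (n zero)) (λ ch → ΣL-map-∘ (chainTuples q r (λ i → n (suc i))) (consF ch) g))

  ΣL-chains-suc : ∀ q n (f : Vec ℕ (suc (suc q)) → Carrier) →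
    ΣL (map f (chains (suc q) n)) ≈ Σ≤ n (λ m → ΣL (map (λ ch → f (n ∷ ch)) (chains q m)))
  ΣL-chains-suc q n f = begin
    ΣL (map f (concatMap (λ m → map (n ∷_) (chains q m)) (upTo (suc n))))
      ≈⟨ ΣL-concatMap (upTo (suc n)) (λ m → map (n ∷_) (chains q m)) f ⟩
    ΣL (map (λ m → ΣL (map f (map (n ∷_) (chains q m)))) (upTo (suc n)))
      ≈⟨ ΣL-upTo n (λ m → ΣL (map f (map (n ∷_) (chains q m)))) ⟩
    Σ≤ n (λ m → ΣL (map f (map (n ∷_) (chains q m))))
      ≈⟨ Σ≤-cong n (λ m _ → ΣL-map-∘ (chains q m) (n ∷_) f) ⟩
    Σ≤ n (λ m → ΣL (map (λ ch → f (n ∷ ch)) (chains q m))) ∎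

  ΣL-chainTuples-zero : ∀ r n (g : (Fin r → Vec ℕ 1) → Carrier) → Extensional g →
    ΣL (map g (chainTuples 0 r n)) ≈ g (λ i → n i ∷ [])
  ΣL-chainTuples-zero zero    n g g-ext = trans (+-identityʳ _) (g-ext (λ ()))
  ΣL-chainTuples-zero (suc r) n g g-ext = begin
    ΣL (map g (chainTuples 0 (suc r) n))
      ≈⟨ trans (ΣL-chainTuples-suc 0 r n g) (+-identityʳ _) ⟩
    ΣL (map (λ M → g (consF (n zero ∷ []) M)) (chainTuples 0 r (λ i → n (suc i))))
      ≈⟨ ΣL-chainTuples-zero r _ _ (λ M≗M′ → g-ext (λ { zero → ≡.refl ; (suc i) → M≗M′ i })) ⟩
    g (consF (n zero ∷ []) (λ i → n (suc i) ∷ []))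
      ≈⟨ g-ext (λ { zero → ≡.refl ; (suc i) → ≡.refl }) ⟩
    g (λ i → n i ∷ []) ∎

  ΣL-chainTuples-split : ∀ q r n (g : (Fin r → Vec ℕ (suc (suc q))) → Carrier) → Extensional g →
    ΣL (map g (chainTuples (suc q) r n)) ≈
      Σbox r n (λ m → ΣL (map (λ M → g (λ i → n i ∷ M i)) (chainTuples q r m)))
  ΣL-chainTuples-split q zero    n g g-ext = +-congʳ (g-ext (λ ()))
  ΣL-chainTuples-split q (suc r) n g g-ext = begin
    ΣL (map g (chainTuples (suc q) (suc r) n))
      ≈⟨ ΣL-chainTuples-suc (suc q) r n g ⟩
    ΣL (map (λ ch → ΣL (map (λ M → g (consF ch M)) (chainTuples (suc q) r n′))) (chains (suc q) n₀))
      ≈⟨ ΣL-chains-suc q n₀ _ ⟩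
    Σ≤ n₀ (λ m₀ → ΣL (map (λ ch → ΣL (map (λ M → g (consF (n₀ ∷ ch) M)) (chainTuples (suc q) r n′))) (chains q m₀)))
      ≈⟨ Σ≤-cong n₀ (λ m₀ _ → ΣL-map-cong (chains q m₀) (λ ch →
           ΣL-chainTuples-split q r n′ _ (λ M≗M′ → g-ext (λ { zero → ≡.refl ; (suc i) → M≗M′ i })))) ⟩
    Σ≤ n₀ (λ m₀ → ΣL (map (λ ch → Σbox r n′ (λ m → G m₀ m ch)) (chains q m₀)))
      ≈⟨ Σ≤-cong n₀ (λ m₀ _ → sym (Σbox-ΣL r n′ (chains q m₀) (λ ch m → G m₀ m ch))) ⟩
    Σ≤ n₀ (λ m₀ → Σbox r n′ (λ m → ΣL (map (G m₀ m) (chains q m₀))))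
      ≈⟨ Σ≤-cong n₀ (λ m₀ _ → Σbox-cong r n′ (λ m _ → sym (trans (ΣL-chainTuples-suc q r (consF m₀ m) _)
           (ΣL-map-cong (chains q m₀) (λ ch → ΣL-map-cong (chainTuples q r m) (λ M →
              g-ext (λ { zero → ≡.refl ; (suc i) → ≡.refl }))))))) ⟩
    Σbox (suc r) n (λ m → ΣL (map (λ M → g (λ i → n i ∷ M i)) (chainTuples q (suc r) m))) ∎
    where
    n₀ = n zero
    n′ : Fin r → ℕ
    n′ i = n (suc i)
    G : ℕ → (Fin r → ℕ) → Vec ℕ (suc q) → Carrier
    G m₀ m ch = ΣL (map (λ M → g (consF (n₀ ∷ ch) (λ i → n′ i ∷ M i))) (chainTuples q r m))

  ι-C-factorial : ∀ {n k} → k ≤ n → ι (n C k) * (ι (k !ℕ) * ι ((n ∸ k) !ℕ)) ≈ ι (n !ℕ)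
  ι-C-factorial {n} {k} k≤n = begin
    ι (n C k) * (ι (k !ℕ) * ι ((n ∸ k) !ℕ))   ≈⟨ sym (trans (ι-* (n C k) _) (*-congˡ (ι-* (k !ℕ) _))) ⟩
    ι ((n C k) *ℕ (k !ℕ *ℕ (n ∸ k) !ℕ))       ≡⟨ ≡.cong ι C-factorial ⟩
    ι (n !ℕ)                                  ∎
    where
    instance _ = k ℕ.!* (n ∸ k) !≢0
    C-factorial : (n C k) *ℕ (k !ℕ *ℕ (n ∸ k) !ℕ) ≡ n !ℕ
    C-factorial = ≡.trans (≡.cong (_*ℕ (k !ℕ *ℕ (n ∸ k) !ℕ)) (nCk≡n!/k![n-k]! k≤n))
                          (m/n*n≡m (k![n∸k]!∣n! k≤n))

  multinomial-split : ∀ {q} n (v : Vec ℕ (suc q)) → head v ≤ n → (y : Fin (suc (suc q)) → Carrier) →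
    multinomial n (suc (suc q)) (nu (n ∷ v)) * ΠF (suc (suc q)) (λ j → y j ^ nu (n ∷ v) j) ≈
      binomialTerm (y zero) n (head v) *
        (multinomial (head v) (suc q) (nu v) * ΠF (suc q) (λ j → y (suc j) ^ nu v j))
  multinomial-split {q} n (m ∷ ms) m≤n y = begin
    (ι (n !ℕ) * (D * Π!) ⁻¹) * (yⁿ⁻ᵐ * Πy)
      ≈⟨ *-congʳ (*-cong (sym (ι-C-factorial m≤n)) (⁻¹-distrib-* (ι-!-≉0 (n ∸ m)) Π!≉0)) ⟩
    ((ι (n C m) * (ι (m !ℕ) * D)) * (D ⁻¹ * Π! ⁻¹)) * (yⁿ⁻ᵐ * Πy)
      ≈⟨ solve 7 (λ c f d d′ p′ y p → ((c :* (f :* d)) :* (d′ :* p′)) :* (y :* p)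
                                    := (c :* y) :* (((f :* p′) :* p) :* (d :* d′)))
           refl (ι (n C m)) (ι (m !ℕ)) D (D ⁻¹) (Π! ⁻¹) yⁿ⁻ᵐ Πy ⟩
    (ι (n C m) * yⁿ⁻ᵐ) * (((ι (m !ℕ) * Π! ⁻¹) * Πy) * (D * D ⁻¹))
      ≈⟨ *-congˡ (trans (*-congˡ (⁻¹-inverseʳ (ι-!-≉0 (n ∸ m)))) (*-identityʳ _)) ⟩
    (ι (n C m) * yⁿ⁻ᵐ) * ((ι (m !ℕ) * Π! ⁻¹) * Πy) ∎
    where
    D = ι ((n ∸ m) !ℕ)
    Π! = ΠF (suc q) (λ j → ι (nu (m ∷ ms) j !ℕ))
    Π!≉0 = ΠF-≉0 (suc q) (λ j → ι-!-≉0 (nu (m ∷ ms) j))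
    yⁿ⁻ᵐ = y zero ^ (n ∸ m)
    Πy = ΠF (suc q) (λ j → y (suc j) ^ nu (m ∷ ms) j)

  termNumerator : (q r : ℕ) → (Fin r → Fin (suc q) → Carrier) → (Fin r → ℕ) → (Fin r → Vec ℕ (suc q)) →
                  Carrier
  termNumerator q r x n N =
    ΠF r (λ i → multinomial (n i) (suc q) (nu (N i)) * ΠF (suc q) (λ j → x i j ^ nu (N i) j))

  termDenominator : (q r : ℕ) → (Fin q → Carrier) → (Fin r → Vec ℕ (suc q)) → Carrier
  termDenominator q r t N = ΠF q (λ j →
    denominator (t j) (sumℕ r (λ i → lookup (N i) (inject₁ j))) (sumℕ r (λ i → nu (N i) (inject₁ j))))

  nu-inject₁-≤ : ∀ {q} (v : Vec ℕ (suc q)) (j : Fin q) → nu v (inject₁ j) ≤ lookup v (inject₁ j)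
  nu-inject₁-≤ (a ∷ b ∷ ms) zero    = ℕ.m∸n≤m a b
  nu-inject₁-≤ (a ∷ b ∷ ms) (suc j) = nu-inject₁-≤ (b ∷ ms) j

  module _ (q r : ℕ) (x : Fin r → Fin (suc q) → Carrier) (t : Fin q → Carrier) where

    termDenominator-≉0 : (∀ j → NotNonPositiveInteger (t j)) → ∀ N → termDenominator q r t N ≉ 0#
    termDenominator-≉0 t∉-ℕ N =
      ΠF-≉0 q (λ j → denominator-≉0 (t∉-ℕ j) (sumℕ-mono-≤ r (λ i → nu-inject₁-≤ (N i) j)))

    term-cong : ∀ n → Extensional (term q r x t n)
    term-cong n N≗N′ = reflexive (≡.cong₂ (λ a b → a * b ⁻¹)
      (ΠF-≡ r (λ i → ≡.cong (λ v → multinomial (n i) (suc q) (nu v) * ΠF (suc q) (λ j → x i j ^ nu v j))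
                            (N≗N′ i)))
      (ΠF-≡ q (λ j → ≡.cong₂ (denominator (t j))
        (sumℕ-cong r (λ i → ≡.cong (λ v → lookup v (inject₁ j)) (N≗N′ i)))
        (sumℕ-cong r (λ i → ≡.cong (λ v → nu v (inject₁ j)) (N≗N′ i))))))
      where
      ΠF-≡ : ∀ l {f g : Fin l → Carrier} → f ≗ g → ΠF l f ≡ ΠF l g
      ΠF-≡ zero    f≗g = ≡.refl
      ΠF-≡ (suc l) f≗g = ≡.cong₂ _*_ (f≗g zero) (ΠF-≡ l (λ i → f≗g (suc i)))

  nu-cons-zero : ∀ {q} a (v : Vec ℕ (suc q)) → nu (a ∷ v) zero ≡ a ∸ head v
  nu-cons-zero a (b ∷ ms) = ≡.refl

  nu-cons-suc : ∀ {q} a (v : Vec ℕ (suc q)) j → nu (a ∷ v) (suc j) ≡ nu v j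
  nu-cons-suc a (b ∷ ms) j = ≡.refl

  module _ (q r : ℕ) (x : Fin r → Fin (suc (suc q)) → Carrier) (t : Fin (suc q) → Carrier)
           (n m : Fin r → ℕ) (M : Fin r → Vec ℕ (suc q))
           (head-M : ∀ i → head (M i) ≡ m i) (m≤n : ∀ i → m i ≤ n i) where

    private
      x₀ : Fin r → Carrier
      x₀ i = x i zero
      x′ : Fin r → Fin (suc q) → Carrier
      x′ i j = x i (suc j)
      t′ : Fin q → Carrier
      t′ j = t (suc j)
      N : Fin r → Vec ℕ (suc (suc q))
      N i = n i ∷ M i

    termNumerator-split : termNumerator (suc q) r x n N ≈ binomialWeight r x₀ n m * termNumerator q r x′ m M
    termNumerator-split = trans (ΠF-cong r (λ i →
      trans (multinomial-split (n i) (M i) (≡.subst (_≤ n i) (≡.sym (head-M i)) (m≤n i)) (x i))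
            (reflexive (≡.cong (λ h → binomialTerm (x₀ i) (n i) h * (multinomial h (suc q) (nu (M i)) * _))
                               (head-M i)))))
      (ΠF-distrib-* r _ _)

    termDenominator-split :
      termDenominator (suc q) r t N ≈
        denominator (t zero) (sumℕ r n) (sumℕ r n ∸ sumℕ r m) * termDenominator q r t′ M
    termDenominator-split = *-cong
      (reflexive (≡.cong (denominator (t zero) (sumℕ r n))
        (≡.trans (sumℕ-cong r (λ i → ≡.trans (nu-cons-zero (n i) (M i)) (≡.cong (n i ∸_) (head-M i))))
                 (sumℕ-∸ r n m m≤n))))
      (ΠF-cong q (λ j → reflexive (≡.cong (denominator (t′ j) (sumℕ r (λ i → lookup (M i) (inject₁ j))))
        (sumℕ-cong r (λ i → nu-cons-suc (n i) (M i) (inject₁ j))))))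

    term-split : (∀ j → NotNonPositiveInteger (t j)) →
      term (suc q) r x t n N ≈
        (binomialWeight r x₀ n m * beta (t zero) (sumℕ r n) (sumℕ r m)) * term q r x′ t′ m M
    term-split t∉-ℕ = begin
      termNumerator (suc q) r x n N * termDenominator (suc q) r t N ⁻¹
        ≈⟨ *-cong termNumerator-split (⁻¹-cong (termDenominator-≉0 (suc q) r x t t∉-ℕ N) termDenominator-split) ⟩
      (W * A) * (D * B) ⁻¹         ≈⟨ *-congˡ (⁻¹-distrib-* D≉0 B≉0) ⟩
      (W * A) * (D ⁻¹ * B ⁻¹)
        ≈⟨ solve 4 (λ w a d b → (w :* a) :* (d :* b) := (w :* d) :* (a :* b)) refl W A (D ⁻¹) (B ⁻¹) ⟩
      (W * D ⁻¹) * (A * B ⁻¹)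
        ≈⟨ *-congʳ (*-congˡ (denominator⁻¹-beta (t∉-ℕ zero) (sumℕ-mono-≤ r m≤n))) ⟩
      (W * beta (t zero) (sumℕ r n) (sumℕ r m)) * term q r x′ t′ m M ∎
      where
      W = binomialWeight r x₀ n m
      A = termNumerator q r x′ m M
      B = termDenominator q r t′ M
      D = denominator (t zero) (sumℕ r n) (sumℕ r n ∸ sumℕ r m)
      D≉0 = denominator-≉0 (t∉-ℕ zero) (ℕ.m∸n≤m (sumℕ r n) (sumℕ r m))
      B≉0 = termDenominator-≉0 q r x′ t′ (λ j → t∉-ℕ (suc j)) M

  coeff≈coeffRec : ∀ q r x t → (∀ j → NotNonPositiveInteger (t j)) →
                   ∀ n → coeff q r x t n ≈ coeffRec q r x t n
  coeff≈coeffRec zero r x t t∉-ℕ n = begin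
    ΣL (map (term 0 r x t n) (chainTuples 0 r n))
      ≈⟨ ΣL-chainTuples-zero r n (term 0 r x t n) (term-cong 0 r x t n) ⟩
    termNumerator 0 r x n (λ i → n i ∷ []) * 1# ⁻¹
      ≈⟨ trans (*-congˡ 1⁻¹≈1) (*-identityʳ _) ⟩
    termNumerator 0 r x n (λ i → n i ∷ [])
      ≈⟨ ΠF-cong r (λ i → trans (*-cong (multinomial-trivial (n i)) (*-identityʳ _)) (*-identityˡ _)) ⟩
    coeffRec zero r x t n ∎
    where
    multinomial-trivial : ∀ k → multinomial k 1 (λ _ → k) ≈ 1#
    multinomial-trivial k =
      trans (*-congˡ (⁻¹-cong (*-≉0 (ι-!-≉0 k) 1≉0) (*-identityʳ _))) (⁻¹-inverseʳ (ι-!-≉0 k))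
  coeff≈coeffRec (suc q) r x t t∉-ℕ n = begin
    ΣL (map (term (suc q) r x t n) (chainTuples (suc q) r n))
      ≈⟨ ΣL-chainTuples-split q r n _ (term-cong (suc q) r x t n) ⟩
    Σbox r n (λ m → ΣL (map (λ M → term (suc q) r x t n (λ i → n i ∷ M i)) (chainTuples q r m)))
      ≈⟨ Σbox-cong r n (λ m m≤n → ΣL-map-cong-All (chainTuples-heads q r m) (λ M head-M →
           term-split q r x t n m M head-M m≤n t∉-ℕ)) ⟩
    Σbox r n (λ m → ΣL (map (λ M → weight m * term q r x′ t′ m M) (chainTuples q r m)))
      ≈⟨ Σbox-cong r n (λ m _ → trans (ΣL-*ˡ (chainTuples q r m) (weight m) _)
           (*-congˡ (coeff≈coeffRec q r x′ t′ (λ j → t∉-ℕ (suc j)) m))) ⟩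
    Σbox r n (λ m → weight m * coeffRec q r x′ t′ m)
      ≈⟨ Σbox-cong r n (λ m _ → *-assoc _ _ _) ⟩
    coeffRec (suc q) r x t n ∎
    where
    x′ : Fin r → Fin (suc q) → Carrier
    x′ i j = x i (suc j)
    t′ : Fin q → Carrier
    t′ j = t (suc j)
    weight : (Fin r → ℕ) → Carrier
    weight m = binomialWeight r (λ i → x i zero) n m * beta (t zero) (sumℕ r n) (sumℕ r m)

module GeneratingFunction {c ℓ : Level} (K : Field c ℓ) (char : FieldDefs.CharacteristicZero K) where
  open FieldDefs K
  open CoeffDefs K
  open Field K hiding (zero)
  open FieldProperties K
  open FiniteSums K
  open Binomial K using (ΠF-bump)
  open Beta K using (NotNonPositiveInteger)
  open Denominators K char using (ι-!-≉0)
  open RecursiveCoefficients K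
  open Expansion K char
  open import Relation.Binary.Reasoning.Setoid setoid

  ∂-genFun : ∀ q r x t i n →
    ∂ i (genFun q r x t) n ≈ coeff q r x t (bump n i) * ΠF r (λ k → ι (n k !ℕ)) ⁻¹
  ∂-genFun q r x t i n = begin
    u * (coeff q r x t (bump n i) * ΠF r (λ k → ι (bump n i k !ℕ)) ⁻¹)
      ≈⟨ sym (*-assoc _ _ _) ⟩
    (u * coeff q r x t (bump n i)) * ΠF r (λ k → ι (bump n i k !ℕ)) ⁻¹
      ≈⟨ *-congˡ (⁻¹-cong (ΠF-≉0 r (λ k → ι-!-≉0 (bump n i k))) n!-bump) ⟩
    (u * coeff q r x t (bump n i)) * (u * n!) ⁻¹
      ≈⟨ *-⁻¹-cancel (char (n i)) (ΠF-≉0 r (λ k → ι-!-≉0 (n k))) ⟩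
    coeff q r x t (bump n i) * n! ⁻¹ ∎
    where
    u = ι (suc (n i))
    n! = ΠF r (λ k → ι (n k !ℕ))
    n!-bump : ΠF r (λ k → ι (bump n i k !ℕ)) ≈ u * n!
    n!-bump = ΠF-bump r (λ k e → ι (e !ℕ)) n i u (ι-!-suc (n i))

  genFun-annihilated : ∀ q r (x : Fin r → Fin (suc q) → Carrier) a {l} (is : Fin l → Fin r) →
    (∀ j → ΣF l (λ k → x (is k) j) ≈ a) → (t : Fin q → Carrier) → (∀ j → NotNonPositiveInteger (t j)) →
    IsZero (operator is a (genFun q r x t))
  genFun-annihilated q r x a {l} is Σx≈a t t∉-ℕ n = begin
    ΣF l (λ k → ∂ (is k) G n) - a * G n
      ≈⟨ +-congʳ (trans (ΣF-cong l (λ k → ∂-genFun q r x t (is k) n)) (ΣF-*ʳ l _ _)) ⟩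
    ΣF l (λ k → cf (bump n (is k))) * n! ⁻¹ - a * G n
      ≈⟨ +-congʳ (*-congʳ Σc-bump) ⟩
    (a * cf n) * n! ⁻¹ - a * G n
      ≈⟨ +-congʳ (*-assoc _ _ _) ⟩
    a * G n - a * G n
      ≈⟨ -‿inverseʳ _ ⟩
    0# ∎
    where
    G = genFun q r x t
    cf = coeff q r x t
    n! = ΠF r (λ k → ι (n k !ℕ))
    Σc-bump : ΣF l (λ k → cf (bump n (is k))) ≈ a * cf n
    Σc-bump = begin
      ΣF l (λ k → cf (bump n (is k)))
        ≈⟨ ΣF-cong l (λ k → coeff≈coeffRec q r x t t∉-ℕ (bump n (is k))) ⟩
      ΣF l (λ k → coeffRec q r x t (bump n (is k)))
        ≈⟨ coeffRec-annihilated q r is x t a t∉-ℕ Σx≈a n ⟩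
      a * coeffRec q r x t n
        ≈⟨ *-congˡ (sym (coeff≈coeffRec q r x t t∉-ℕ n)) ⟩
      a * cf n ∎

theorem4p2 : ∀ {c ℓ : Level} (K : Field c ℓ) →
    let open FieldStuff K in
    CharacteristicZero →
    (r q : ℕ) → 1 ≤ r →
    (x : Fin r → Fin (suc q) → Carrier) → (a : Carrier) →
    (m : ℕ) → (is : Fin m → Fin r) → Injective _≡_ _≡_ is →
    (∀ j → ΣF m (λ k → x (is k) j) ≈ a) →
    (t : Fin q → Carrier) → (∀ j n → ¬ (t j ≈ - ι n)) →
    IsZero (operator is a (genFun q r x t))
theorem4p2 K char r q _ x a m is _ Σx≈a t t∉-ℕ =
  GeneratingFunction.genFun-annihilated K char q r x a is Σx≈a t t∉-ℕ
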